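{- For $n\ge 1$, $i_{dR}(P_n)=n$ if $n\equiv 0 \pmod 3$ and $i_{dR}(P_n)=n+1$ otherwise. For $n\ge 3$, $i_{dR}(C_n)=n$ if $n\equiv 0,2,3,4 \pmod 6$ and $i_{dR}(C_n)=n+1$ otherwise.
   Context: $P_n$ and $C_n$ denote the path and the cycle on $n$ vertices. An independent double Roman dominating function (IDRDF) on a graph $G=(V,E)$ is a function $f:V\to\{0,1,2,3\}$ such that: every vertex $v$ with $f(v)=0$ has at least two neighbors $w$ with $f(w)=2$ or at least one neighbor $w$ with $f(w)=3$; every vertex $v$ with $f(v)=1$ has a neighbor $w$ with $f(w)\ge 2$; and $\{v: f(v)>0\}$ is an independent set. The weight of $f$ is $\sum_{v\in V}f(v)$, and the independent double Roman domination number $i_{dR}(G)$ is the minimum weight of an IDRDF on $G$. -}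

module Defs where

open import Data.Nat using (ℕ; zero; suc; _+_; _≤_; _≥_)
open import Data.Fin using (Fin; toℕ)
open import Data.List using (map; allFin)
open import Data.Nat.ListAction using (sum)
open import Data.Product using (_×_; Σ-syntax; ∃-syntax)
open import Data.Sum using (_⊎_)
open import Relation.Nullary using (¬_)
open import Relation.Binary.PropositionalEquality using (_≡_; _≢_)

Graph : ℕ → Set₁
Graph n = Fin n → Fin n → Set

PathAdj : (n : ℕ) → Graph n
PathAdj n i j = (suc (toℕ i) ≡ toℕ j) ⊎ (suc (toℕ j) ≡ toℕ i)

-- Cycle C_n (intended for n ≥ 3): path edges plus the edge {0, n-1}.
CycleAdj : (n : ℕ) → Graph n
CycleAdj n i j =
  PathAdj n i j
  ⊎ ((toℕ i ≡ 0 × suc (toℕ j) ≡ n) ⊎ (toℕ j ≡ 0 × suc (toℕ i) ≡ n))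

Labeling : ℕ → Set
Labeling n = Fin n → ℕ

weight : ∀ {n} → Labeling n → ℕ
weight {n} f = sum (map f (allFin n))

record IsIDRDF {n : ℕ} (G : Graph n) (f : Labeling n) : Set where
  field
    range : ∀ v → f v ≤ 3
    zero-cond : ∀ v → f v ≡ 0 →
      (Σ[ w ∈ Fin n ] Σ[ w' ∈ Fin n ]
         (w ≢ w' × G v w × f w ≡ 2 × G v w' × f w' ≡ 2))
      ⊎ (∃[ w ] (G v w × f w ≡ 3))
    one-cond : ∀ v → f v ≡ 1 → ∃[ w ] (G v w × 2 ≤ f w)
    independent : ∀ u v → G u v → ¬ (1 ≤ f u × 1 ≤ f v)

IsIdRNumber : {n : ℕ} → Graph n → ℕ → Set
IsIdRNumber {n} G m =
  (∃[ f ] (IsIDRDF G f × weight f ≡ m))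
  × (∀ f → IsIDRDF G f → m ≤ weight f)

module Submission where

-- Along a path or cycle an IDRDF uses only the labels 0, 2, 3 (a 1 would need a
-- positive neighbour), so it is a label sequence s in which positions 1 … n
-- carry the vertices, positions 0 and n + 1 describe what lies beyond the ends,
-- and every window of three consecutive labels is 'Valid'.
--
-- Lower bound by discharging: a 3 sends charge 2, a 2 sends charge 1 to each
-- empty neighbour; every vertex then keeps at least 2, and summing telescopes
-- to 2n + excess = 2 · weight up to charge crossing the ends ('discharge'), so
-- weight ≥ n. If weight = n all windows are tight, and tight windows generate
-- the sequence by a map on label pairs whose orbits have length 2 or 3; closing
-- up the path (pairs (0,0) at both ends) or cycle forces 3 ∣ n, resp. 2 ∣ n or
-- 3 ∣ n. Upper bound: the periodic patterns (0 0 3)*, (0 2)* and variants.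

open import Defs
open import Data.Nat using (ℕ; zero; suc; _+_; _*_; _∸_; _≤_; _<_; _%_; _/_; z≤n; s≤s; NonZero; _<?_)
open import Data.Nat.Properties
open import Data.Nat.DivMod using (m≡m%n+[m/n]*n; m%n<n; n%n≡0; m<n⇒m%n≡m; m∣n⇒o%n%m≡o%m)
open import Data.Nat.Divisibility using (divides)
open import Data.Nat.GeneralisedArithmetic using (fold; fold-+)
open import Data.Nat.ListAction using (sum)
open import Data.Nat.Tactic.RingSolver using (solve-∀)
open import Data.Fin using (Fin; toℕ; fromℕ<)
import Data.Fin as Fin
open import Data.Fin.Properties using (toℕ-fromℕ<; fromℕ<-toℕ; fromℕ<-cong; toℕ<n; toℕ-injective)
open import Data.List using (tabulate)
open import Data.List.Properties using (map-tabulate)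
open import Data.Product using (_×_; _,_; proj₁; proj₂; Σ-syntax; ∃-syntax)
open import Data.Sum using (_⊎_; inj₁; inj₂; [_,_]′) renaming (map to map-⊎)
open import Function using (id)
open import Relation.Nullary using (¬_; yes; no; contradiction)
open import Relation.Binary.PropositionalEquality
  using (_≡_; _≢_; refl; sym; trans; cong; cong₂; subst; module ≡-Reasoning)

data Label : Set where
  L0 L2 L3 : Label

val : Label → ℕ
val L0 = 0
val L2 = 2
val L3 = 3

-- Valid x y z: a vertex labelled y whose neighbours are labelled x and z
-- (L0 standing also for a missing neighbour) satisfies the IDRDF conditions.
data Valid : Label → Label → Label → Set where
  three-left  : ∀ {z} → Valid L3 L0 z
  three-right : ∀ {x} → Valid x L0 L3
  two-two     : Valid L2 L0 L2
  lone-two    : Valid L0 L2 L0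
  lone-three  : Valid L0 L3 L0

valid-cong : ∀ {x x′ y y′ z z′} → x ≡ x′ → y ≡ y′ → z ≡ z′ → Valid x y z → Valid x′ y′ z′
valid-cong refl refl refl v = v

valid-empty : ∀ {x z} → x ≡ L3 ⊎ z ≡ L3 ⊎ (x ≡ L2 × z ≡ L2) → Valid x L0 z
valid-empty (inj₁ refl)                 = three-left
valid-empty (inj₂ (inj₁ refl))          = three-right
valid-empty (inj₂ (inj₂ (refl , refl))) = two-two

valid-occupied : ∀ {x y z} → y ≢ L0 → x ≡ L0 → z ≡ L0 → Valid x y z
valid-occupied {y = L0} y≢L0 _    _    = contradiction refl y≢L0
valid-occupied {y = L2} _    refl refl = lone-two
valid-occupied {y = L3} _    refl refl = lone-three

empty-needs : ∀ {x y z} → Valid x y z → y ≡ L0 → x ≡ L3 ⊎ z ≡ L3 ⊎ (x ≡ L2 × z ≡ L2)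
empty-needs three-left  _ = inj₁ refl
empty-needs three-right _ = inj₂ (inj₁ refl)
empty-needs two-two     _ = inj₂ (inj₂ (refl , refl))

occupied-isolated : ∀ {x y z} → Valid x y z → y ≢ L0 → x ≡ L0 × z ≡ L0
occupied-isolated three-left  y≢L0 = contradiction refl y≢L0
occupied-isolated three-right y≢L0 = contradiction refl y≢L0
occupied-isolated two-two     y≢L0 = contradiction refl y≢L0
occupied-isolated lone-two    _    = refl , refl
occupied-isolated lone-three  _    = refl , refl

-- Charge sent by a vertex labelled x to a neighbour labelled y.
give : Label → Label → ℕ
give L2 L0 = 1
give L3 L0 = 2
give _  _  = 0

give-to-empty : ∀ y → give y L0 ≡ 0 → y ≡ L0
give-to-empty L0 _ = refl

-- Surplus of the centre y of a window over the charge 2 it must end with.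
excess : Label → Label → Label → ℕ
excess x y z = (2 * val y + (give x y + give z y)) ∸ (2 + (give y x + give y z))

balance : ∀ {x y z} → Valid x y z →
          2 + (give y x + give y z) + excess x y z ≡ 2 * val y + (give x y + give z y)
balance {z = L0} three-left  = refl
balance {z = L2} three-left  = refl
balance {z = L3} three-left  = refl
balance {x = L0} three-right = refl
balance {x = L2} three-right = refl
balance {x = L3} three-right = refl
balance two-two    = refl
balance lone-two   = refl
balance lone-three = refl

-- The label following x y in a tight window.
next : Label → Label → Label
next L0 L0 = L3
next L2 L0 = L2
next _  _  = L0

-- The tight windows are 0 0 3, 0 3 0, 3 0 0, 0 2 0 and 2 0 2, so in a tight
-- window the last label is determined by the first two.
tight-next : ∀ {x y z} → Valid x y z → excess x y z ≡ 0 → z ≡ next x y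
tight-next {z = L0} three-left  _ = refl
tight-next {x = L0} three-right _ = refl
tight-next two-two    _ = refl
tight-next lone-two   _ = refl
tight-next lone-three _ = refl

record HasPeriod {A : Set} (g : A → A) (a : A) (p : ℕ) : Set where
  field
    returns : fold a g p ≡ a
    minimal : ∀ i → i < p → fold a g i ≡ a → i ≡ 0

module _ {A : Set} {g : A → A} {a : A} {p : ℕ} (period : HasPeriod g a p) where
  open HasPeriod period
  open ≡-Reasoning

  returns-multiple : ∀ q → fold a g (q * p) ≡ a
  returns-multiple zero    = refl
  returns-multiple (suc q) = begin
    fold a g (p + q * p)        ≡⟨ fold-+ a g p ⟩
    fold (fold a g (q * p)) g p ≡⟨ cong (λ b → fold b g p) (returns-multiple q) ⟩
    fold a g p                  ≡⟨ returns ⟩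
    a                           ∎

  return-time-divisible : .{{_ : NonZero p}} → ∀ n → fold a g n ≡ a → n % p ≡ 0
  return-time-divisible n back = minimal (n % p) (m%n<n n p) (begin
    fold a g (n % p)                      ≡⟨ cong (λ b → fold b g (n % p)) (returns-multiple (n / p)) ⟨
    fold (fold a g (n / p * p)) g (n % p) ≡⟨ fold-+ a g (n % p) ⟨
    fold a g (n % p + n / p * p)          ≡⟨ cong (fold a g) (m≡m%n+[m/n]*n n p) ⟨
    fold a g n                            ≡⟨ back ⟩
    a                                     ∎)

-- A tight sequence moves through pairs of consecutive labels by 'step'.
State : Set
State = Label × Label

step : State → State
step (x , y) = y , next x y

two-cycle : ∀ σ → step (step σ) ≡ σ → step σ ≢ σ → HasPeriod step σ 2
two-cycle σ back moved = record { returns = back ; minimal = minimal }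
  where
  minimal : ∀ i → i < 2 → fold σ step i ≡ σ → i ≡ 0
  minimal zero          _ _  = refl
  minimal (suc zero)    _ eq = contradiction eq moved
  minimal (suc (suc _)) (s≤s (s≤s ())) _

three-cycle : ∀ σ → step (step (step σ)) ≡ σ → step σ ≢ σ → step (step σ) ≢ σ → HasPeriod step σ 3
three-cycle σ back moved₁ moved₂ = record { returns = back ; minimal = minimal }
  where
  minimal : ∀ i → i < 3 → fold σ step i ≡ σ → i ≡ 0
  minimal zero                _ _  = refl
  minimal (suc zero)          _ eq = contradiction eq moved₁
  minimal (suc (suc zero))    _ eq = contradiction eq moved₂
  minimal (suc (suc (suc _))) (s≤s (s≤s (s≤s ()))) _

-- The pairs starting a tight window lie on the orbits (0 2)(2 0) or (0 0)(0 3)(3 0).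
tight-period : ∀ {x y z} → Valid x y z → excess x y z ≡ 0 →
               HasPeriod step (x , y) 2 ⊎ HasPeriod step (x , y) 3
tight-period {z = L0} three-left  _ = inj₂ (three-cycle _ refl (λ ()) (λ ()))
tight-period {x = L0} three-right _ = inj₂ (three-cycle _ refl (λ ()) (λ ()))
tight-period two-two    _ = inj₁ (two-cycle _ refl (λ ()))
tight-period lone-two   _ = inj₁ (two-cycle _ refl (λ ()))
tight-period lone-three _ = inj₂ (three-cycle _ refl (λ ()) (λ ()))

Seq : Set
Seq = ℕ → Label

_◂_ : Label → Seq → Seq
(x ◂ s) zero    = x
(x ◂ s) (suc i) = s i

sumBelow : ℕ → (ℕ → ℕ) → ℕ
sumBelow zero    g = 0
sumBelow (suc n) g = g 0 + sumBelow n (λ i → g (suc i))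

ValidUpTo : ℕ → Seq → Set
ValidUpTo n s = ∀ i → i < n → Valid (s i) (s (suc i)) (s (suc (suc i)))

weightOf : ℕ → Seq → ℕ
weightOf n s = sumBelow n (λ i → val (s (suc i)))

excessOf : ℕ → Seq → ℕ
excessOf n s = sumBelow n (λ i → excess (s i) (s (suc i)) (s (suc (suc i))))

private
  rearrangeˡ : ∀ n E X b₁ b₀ e a₁ →
    2 * (1 + n) + (e + E) + X + b₀ + (a₁ + b₁) ≡ (2 * n + E + X + b₁) + (2 + (b₀ + a₁) + e)
  rearrangeˡ = solve-∀

  rearrangeʳ : ∀ W a₁ Y v a₀ b₁ →
    2 * (v + W) + a₀ + Y + (a₁ + b₁) ≡ (2 * W + a₁ + Y) + (2 * v + (a₀ + b₁))
  rearrangeʳ = solve-∀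

-- Summing 'balance' over positions 1 … n: charge exchanged inside cancels, and
-- only the charge crossing the boundary edges (0,1) and (n,n+1) remains.
discharge : ∀ n s → ValidUpTo n s →
  2 * n + excessOf n s + give (s n) (s (suc n)) + give (s 1) (s 0)
    ≡ 2 * weightOf n s + give (s 0) (s 1) + give (s (suc n)) (s n)
discharge zero    s _     = refl
discharge (suc n) s valid = +-cancelʳ-≡ (a₁ + b₁) _ _ (begin
    2 * (1 + n) + (e₀ + E) + X + b₀ + (a₁ + b₁) ≡⟨ rearrangeˡ n E X b₁ b₀ e₀ a₁ ⟩
    (2 * n + E + X + b₁) + (2 + (b₀ + a₁) + e₀) ≡⟨ cong₂ _+_ rest (balance (valid 0 (s≤s z≤n))) ⟩
    (2 * W + a₁ + Y) + (2 * v + (a₀ + b₁))     ≡⟨ rearrangeʳ W a₁ Y v a₀ b₁ ⟨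
    2 * (v + W) + a₀ + Y + (a₁ + b₁)           ∎)
  where
  open ≡-Reasoning
  s′ : Seq
  s′ i = s (suc i)
  E W e₀ v a₀ b₀ a₁ b₁ X Y : ℕ
  E  = excessOf n s′
  W  = weightOf n s′
  e₀ = excess (s 0) (s 1) (s 2)
  v  = val (s 1)
  a₀ = give (s 0) (s 1)
  b₀ = give (s 1) (s 0)
  a₁ = give (s 1) (s 2)
  b₁ = give (s 2) (s 1)
  X  = give (s (suc n)) (s (suc (suc n)))
  Y  = give (s (suc (suc n))) (s (suc n))
  rest : 2 * n + E + X + b₁ ≡ 2 * W + a₁ + Y
  rest = discharge n s′ (λ i i<n → valid (suc i) (s≤s i<n))

sumBelow-zero : ∀ n g → sumBelow n g ≡ 0 → ∀ i → i < n → g i ≡ 0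
sumBelow-zero (suc n) g total zero    _         = m+n≡0⇒m≡0 (g 0) total
sumBelow-zero (suc n) g total (suc i) (s≤s i<n) =
  sumBelow-zero n (λ j → g (suc j)) (m+n≡0⇒n≡0 (g 0) total) i i<n

window : Seq → ℕ → State
window s i = s i , s (suc i)

orbit : ∀ n s → (∀ i → i < n → s (suc (suc i)) ≡ next (s i) (s (suc i))) →
        window s n ≡ fold (window s 0) step n
orbit zero    s _         = refl
orbit (suc n) s generated = begin
  s (suc n) , s (suc (suc n))     ≡⟨ cong (s (suc n) ,_) (generated n ≤-refl) ⟩
  step (window s n)               ≡⟨ cong step (orbit n s (λ i i<n → generated i (m≤n⇒m≤1+n i<n))) ⟩
  step (fold (window s 0) step n) ∎
  where open ≡-Reasoning

rigid : ∀ n s → ValidUpTo n s → excessOf n s ≡ 0 → window s n ≡ fold (window s 0) step n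
rigid n s valid noExcess = orbit n s λ i i<n →
  tight-next (valid i i<n) (sumBelow-zero n _ noExcess i i<n)

-- Label sequence of an IDRDF of P_n: nothing beyond the two ends.
record IsPathSequence (n : ℕ) (s : Seq) : Set where
  field
    windows   : ValidUpTo n s
    left-end  : s 0 ≡ L0
    right-end : s (suc n) ≡ L0

-- Label sequence of an IDRDF of C_n: beyond each end the other end reappears.
record IsCycleSequence (n : ℕ) (s : Seq) : Set where
  field
    windows : ValidUpTo n s
    wrap₀   : s n ≡ s 0
    wrap₁   : s (suc n) ≡ s 1

private
  regroup : ∀ a b c d → a + (b + c + d) ≡ a + b + c + d
  regroup = solve-∀

module PathBounds {n : ℕ} {s : Seq} (path : IsPathSequence n s) where
  open IsPathSequence path
  open ≡-Reasoning

  -- Charge sent across the ends is lost; nothing enters from outside.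
  balance-sheet : 2 * n + (excessOf n s + give (s n) L0 + give (s 1) L0) ≡ 2 * weightOf n s
  balance-sheet = begin
    2 * n + (excessOf n s + give (s n) L0 + give (s 1) L0)
      ≡⟨ regroup (2 * n) (excessOf n s) _ _ ⟩
    2 * n + excessOf n s + give (s n) L0 + give (s 1) L0
      ≡⟨ cong₂ (λ x y → 2 * n + excessOf n s + give (s n) x + give (s 1) y) (sym right-end) (sym left-end) ⟩
    2 * n + excessOf n s + give (s n) (s (suc n)) + give (s 1) (s 0)
      ≡⟨ discharge n s windows ⟩
    2 * weightOf n s + give (s 0) (s 1) + give (s (suc n)) (s n)
      ≡⟨ cong₂ (λ x y → 2 * weightOf n s + give x (s 1) + give y (s n)) left-end right-end ⟩
    2 * weightOf n s + 0 + 0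
      ≡⟨ trans (+-identityʳ _) (+-identityʳ _) ⟩
    2 * weightOf n s ∎

  lower : n ≤ weightOf n s
  lower = *-cancelˡ-≤ 2 (subst (2 * n ≤_) balance-sheet (m≤m+n (2 * n) _))

  -- Weight n forces no excess and no loss at the ends, so both end pairs are
  -- (0, 0) and the sequence runs through whole periods of (0 0 3).
  extremal : weightOf n s ≡ n → n % 3 ≡ 0
  extremal W≡n = return-time-divisible (three-cycle (L0 , L0) refl (λ ()) (λ ())) n (begin
    fold (L0 , L0) step n    ≡⟨ cong (λ σ → fold σ step n) (cong₂ _,_ (sym left-end) (sym first-empty)) ⟩
    fold (window s 0) step n ≡⟨ rigid n s windows noExcess ⟨
    window s n               ≡⟨ cong₂ _,_ last-empty right-end ⟩
    (L0 , L0)                ∎)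
    where
    losses≡0 : excessOf n s + give (s n) L0 + give (s 1) L0 ≡ 0
    losses≡0 = +-cancelˡ-≡ (2 * n) _ _ (trans balance-sheet (trans (cong (2 *_) W≡n) (sym (+-identityʳ _))))
    noExcess : excessOf n s ≡ 0
    noExcess = m+n≡0⇒m≡0 (excessOf n s) (m+n≡0⇒m≡0 _ losses≡0)
    last-empty : s n ≡ L0
    last-empty = give-to-empty (s n) (m+n≡0⇒n≡0 (excessOf n s) (m+n≡0⇒m≡0 _ losses≡0))
    first-empty : s 1 ≡ L0
    first-empty = give-to-empty (s 1) (m+n≡0⇒n≡0 (excessOf n s + give (s n) L0) losses≡0)

module CycleBounds {n : ℕ} {s : Seq} (cycle : IsCycleSequence n s) where
  open IsCycleSequence cycle
  open ≡-Reasoning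

  -- On a cycle no charge is lost.
  balance-sheet : 2 * n + excessOf n s ≡ 2 * weightOf n s
  balance-sheet = +-cancelʳ-≡ (a + b) _ _ (begin
    2 * n + excessOf n s + (a + b)
      ≡⟨ +-assoc (2 * n + excessOf n s) a b ⟨
    2 * n + excessOf n s + a + b
      ≡⟨ cong₂ (λ x y → 2 * n + excessOf n s + give x y + b) (sym wrap₀) (sym wrap₁) ⟩
    2 * n + excessOf n s + give (s n) (s (suc n)) + b
      ≡⟨ discharge n s windows ⟩
    2 * weightOf n s + a + give (s (suc n)) (s n)
      ≡⟨ cong₂ (λ x y → 2 * weightOf n s + a + give x y) wrap₁ wrap₀ ⟩
    2 * weightOf n s + a + b
      ≡⟨ +-assoc (2 * weightOf n s) a b ⟩
    2 * weightOf n s + (a + b) ∎)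
    where
    a b : ℕ
    a = give (s 0) (s 1)
    b = give (s 1) (s 0)

  lower : n ≤ weightOf n s
  lower = *-cancelˡ-≤ 2 (subst (2 * n ≤_) balance-sheet (m≤m+n (2 * n) _))

  -- Weight n makes the first pair return to itself after n steps.
  extremal : 0 < n → weightOf n s ≡ n → n % 2 ≡ 0 ⊎ n % 3 ≡ 0
  extremal 0<n W≡n =
    map-⊎ (λ period → return-time-divisible period n returns)
          (λ period → return-time-divisible period n returns)
          (tight-period (windows 0 0<n) (sumBelow-zero n _ noExcess 0 0<n))
    where
    noExcess : excessOf n s ≡ 0
    noExcess = +-cancelˡ-≡ (2 * n) _ _ (trans balance-sheet (trans (cong (2 *_) W≡n) (sym (+-identityʳ _))))
    returns : fold (window s 0) step n ≡ window s 0
    returns = trans (sym (rigid n s windows noExcess)) (cong₂ _,_ wrap₀ wrap₁)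

label : ℕ → Label
label 2 = L2
label 3 = L3
label _ = L0

val-empty : ∀ {ℓ} → val ℓ ≡ 0 → ℓ ≡ L0
val-empty {L0} _ = refl

extend : ∀ {n} → (Fin n → Label) → ℕ → Label
extend {n} φ k with k <? n
... | yes k<n = φ (fromℕ< k<n)
... | no  _   = L0

module _ {n : ℕ} (φ : Fin n → Label) where

  extend-inside : ∀ {k} (k<n : k < n) → extend φ k ≡ φ (fromℕ< k<n)
  extend-inside {k} k<n with k <? n
  ... | yes k<n′ = cong φ (fromℕ<-cong k k refl k<n′ k<n)
  ... | no  k≮n  = contradiction k<n k≮n

  extend-outside : ∀ {k} → n ≤ k → extend φ k ≡ L0
  extend-outside {k} n≤k with k <? n
  ... | yes k<n = contradiction k<n (≤⇒≯ n≤k)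
  ... | no  _   = refl

  extend-vertex : ∀ v → extend φ (toℕ v) ≡ φ v
  extend-vertex v = trans (extend-inside (toℕ<n v)) (cong φ (fromℕ<-toℕ v (toℕ<n v)))

  extend-occupied : ∀ {k ℓ} → extend φ k ≡ ℓ → ℓ ≢ L0 → Σ[ k<n ∈ k < n ] φ (fromℕ< k<n) ≡ ℓ
  extend-occupied {k} eq ℓ≢L0 with k <? n
  ... | yes k<n = k<n , eq
  ... | no  _   = contradiction (sym eq) ℓ≢L0

extend-cong : ∀ {n} {φ ψ : Fin n → Label} → (∀ v → φ v ≡ ψ v) → ∀ k → extend φ k ≡ extend ψ k
extend-cong {n} φ≗ψ k with k <? n
... | yes k<n = φ≗ψ (fromℕ< k<n)
... | no  _   = refl

-- A graph in which every vertex v has its neighbours among the two positions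
-- 'left (toℕ v)' and 'right (toℕ v)'; positions ≥ n mean "no neighbour".
record Neighbourhood {n : ℕ} (G : Graph n) (left right : ℕ → ℕ) : Set where
  field
    neighbour    : ∀ v w → G v w → toℕ w ≡ left (toℕ v) ⊎ toℕ w ≡ right (toℕ v)
    left-adj     : ∀ v (p : left (toℕ v) < n) → G v (fromℕ< p)
    right-adj    : ∀ v (p : right (toℕ v) < n) → G v (fromℕ< p)
    sides-differ : (v : Fin n) → left (toℕ v) < n → right (toℕ v) < n → left (toℕ v) ≢ right (toℕ v)

LocallyValid : ∀ {n} → (ℕ → ℕ) → (ℕ → ℕ) → (Fin n → Label) → Set
LocallyValid left right φ = ∀ v → Valid (extend φ (left (toℕ v))) (φ v) (extend φ (right (toℕ v)))

local-cong : ∀ {n left right} {φ ψ : Fin n → Label} → (∀ v → φ v ≡ ψ v) →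
             LocallyValid left right φ → LocallyValid left right ψ
local-cong {left = left} {right} φ≗ψ local v =
  valid-cong (extend-cong φ≗ψ (left (toℕ v))) (φ≗ψ v) (extend-cong φ≗ψ (right (toℕ v))) (local v)

module FromIDRDF {n : ℕ} {G : Graph n} {left right : ℕ → ℕ} (N : Neighbourhood G left right)
                 {f : Labeling n} (idrdf : IsIDRDF G f) where
  open Neighbourhood N
  open IsIDRDF idrdf

  φ : Fin n → Label
  φ v = label (f v)

  -- A vertex labelled 1 would need a neighbour labelled ≥ 2, which independence forbids.
  no-ones : ∀ v → f v ≢ 1
  no-ones v fv≡1 with one-cond v fv≡1
  ... | w , vw , 2≤fw = independent v w vw (≤-reflexive (sym fv≡1) , ≤-trans (s≤s z≤n) 2≤fw)

  faithful : ∀ v → f v ≡ val (φ v)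
  faithful v with f v | range v | no-ones v
  ... | 0 | _ | _    = refl
  ... | 1 | _ | not1 = contradiction refl not1
  ... | 2 | _ | _    = refl
  ... | 3 | _ | _    = refl
  ... | suc (suc (suc (suc _))) | s≤s (s≤s (s≤s ())) | _

  seen : ∀ {w k c} → toℕ w ≡ k → f w ≡ c → extend φ k ≡ label c
  seen {w} refl fw≡c = trans (extend-vertex φ w) (cong label fw≡c)

  side-empty : ∀ v k → ((k<n : k < n) → G v (fromℕ< k<n)) → 1 ≤ f v → extend φ k ≡ L0
  side-empty v k adj occupied with ≤-<-connex n k
  ... | inj₁ n≤k = extend-outside φ n≤k
  ... | inj₂ k<n = trans (extend-inside φ k<n)
                     (cong label (n<1⇒n≡0 (≰⇒> λ 1≤fw → independent v _ (adj k<n) (occupied , 1≤fw))))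

  -- The two witnesses of a 0 with two 2-neighbours are on different sides.
  zero-neighbours : ∀ v → f v ≡ 0 →
      extend φ (left (toℕ v)) ≡ L3 ⊎ extend φ (right (toℕ v)) ≡ L3
    ⊎ (extend φ (left (toℕ v)) ≡ L2 × extend φ (right (toℕ v)) ≡ L2)
  zero-neighbours v fv with zero-cond v fv
  ... | inj₂ (w , vw , fw≡3) with neighbour v w vw
  ...   | inj₁ onLeft  = inj₁ (seen onLeft fw≡3)
  ...   | inj₂ onRight = inj₂ (inj₁ (seen onRight fw≡3))
  zero-neighbours v fv | inj₁ (w , w′ , w≢w′ , vw , fw≡2 , vw′ , fw′≡2)
    with neighbour v w vw | neighbour v w′ vw′
  ... | inj₁ l | inj₁ l′ = contradiction (toℕ-injective (trans l (sym l′))) w≢w′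
  ... | inj₁ l | inj₂ r′ = inj₂ (inj₂ (seen l fw≡2 , seen r′ fw′≡2))
  ... | inj₂ r | inj₁ l′ = inj₂ (inj₂ (seen l′ fw′≡2 , seen r fw≡2))
  ... | inj₂ r | inj₂ r′ = contradiction (toℕ-injective (trans r (sym r′))) w≢w′

  -- By independence both sides of a positive vertex are empty.
  isolated : ∀ v {y} → 1 ≤ f v → y ≢ L0 → Valid (extend φ (left (toℕ v))) y (extend φ (right (toℕ v)))
  isolated v occupied y≢L0 =
    valid-occupied y≢L0 (side-empty v _ (left-adj v) occupied) (side-empty v _ (right-adj v) occupied)

  local : LocallyValid left right φ
  local v with f v in fv | range v | no-ones v
  ... | 0 | _ | _    = valid-empty (zero-neighbours v fv)
  ... | 1 | _ | not1 = contradiction refl not1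
  ... | 2 | _ | _    = isolated v (subst (1 ≤_) (sym fv) (s≤s z≤n)) (λ ())
  ... | 3 | _ | _    = isolated v (subst (1 ≤_) (sym fv) (s≤s z≤n)) (λ ())
  ... | suc (suc (suc (suc _))) | s≤s (s≤s (s≤s ())) | _

module ToIDRDF {n : ℕ} {G : Graph n} {left right : ℕ → ℕ} (N : Neighbourhood G left right)
               (φ : Fin n → Label) (local : LocallyValid left right φ) where
  open Neighbourhood N

  range : ∀ v → val (φ v) ≤ 3
  range v with φ v
  ... | L0 = z≤n
  ... | L2 = s≤s (s≤s z≤n)
  ... | L3 = ≤-refl

  no-ones : ∀ v → val (φ v) ≢ 1
  no-ones v with φ v
  ... | L0 = λ ()
  ... | L2 = λ ()
  ... | L3 = λ ()

  occupied : ∀ v → 1 ≤ val (φ v) → φ v ≢ L0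
  occupied v 1≤ φv≡L0 = contradiction (subst (λ ℓ → 1 ≤ val ℓ) φv≡L0 1≤) λ ()

  zero-cond : ∀ v → val (φ v) ≡ 0 →
      (Σ[ w ∈ Fin n ] Σ[ w′ ∈ Fin n ] (w ≢ w′ × G v w × val (φ w) ≡ 2 × G v w′ × val (φ w′) ≡ 2))
    ⊎ (∃[ w ] (G v w × val (φ w) ≡ 3))
  zero-cond v e with empty-needs (local v) (val-empty e)
  ... | inj₁ x≡L3 with extend-occupied φ x≡L3 (λ ())
  ...   | p , φw = inj₂ (fromℕ< p , left-adj v p , cong val φw)
  zero-cond v e | inj₂ (inj₁ z≡L3) with extend-occupied φ z≡L3 (λ ())
  ...   | p , φw = inj₂ (fromℕ< p , right-adj v p , cong val φw)
  zero-cond v e | inj₂ (inj₂ (x≡L2 , z≡L2))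
    with extend-occupied φ x≡L2 (λ ()) | extend-occupied φ z≡L2 (λ ())
  ... | p , φw | p′ , φw′ =
    inj₁ (fromℕ< p , fromℕ< p′ , differ , left-adj v p , cong val φw , right-adj v p′ , cong val φw′)
    where
    differ : fromℕ< p ≢ fromℕ< p′
    differ eq = sides-differ v p p′ (trans (sym (toℕ-fromℕ< p)) (trans (cong toℕ eq) (toℕ-fromℕ< p′)))

  independent : ∀ u w → G u w → ¬ (1 ≤ val (φ u) × 1 ≤ val (φ w))
  independent u w uw (1≤u , 1≤w) = occupied w 1≤w (trans (sym (extend-vertex φ w)) (side (neighbour u w uw)))
    where
    isolated : extend φ (left (toℕ u)) ≡ L0 × extend φ (right (toℕ u)) ≡ L0
    isolated = occupied-isolated (local u) (occupied u 1≤u)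
    side : toℕ w ≡ left (toℕ u) ⊎ toℕ w ≡ right (toℕ u) → extend φ (toℕ w) ≡ L0
    side (inj₁ l) = trans (cong (extend φ) l) (proj₁ isolated)
    side (inj₂ r) = trans (cong (extend φ) r) (proj₂ isolated)

  idrdf : IsIDRDF G (λ v → val (φ v))
  idrdf = record
    { range       = range
    ; zero-cond   = zero-cond
    ; one-cond    = λ v e → contradiction e (no-ones v)
    ; independent = independent
    }

before : ℕ → ℕ → ℕ
before d zero    = d
before d (suc k) = k

before-suc : ∀ {d w t} → suc w ≡ t → w ≡ before d t
before-suc refl = refl

-- In P_n the sides of vertex j are j - 1 (absent for j = 0) and j + 1 (absent for j = n - 1).
path-neighbourhood : ∀ n → Neighbourhood (PathAdj n) (before n) suc
path-neighbourhood n = record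
  { neighbour    = neighbour
  ; left-adj     = λ v → left-adj v (toℕ v) refl
  ; right-adj    = λ v p → inj₁ (sym (toℕ-fromℕ< p))
  ; sides-differ = λ v → sides-differ (toℕ v)
  }
  where
  neighbour : ∀ v w → PathAdj n v w → toℕ w ≡ before n (toℕ v) ⊎ toℕ w ≡ suc (toℕ v)
  neighbour v w (inj₁ e) = inj₂ (sym e)
  neighbour v w (inj₂ e) = inj₁ (before-suc e)
  left-adj : ∀ v t → toℕ v ≡ t → (p : before n t < n) → PathAdj n v (fromℕ< p)
  left-adj v zero    _ p = contradiction p (<-irrefl refl)
  left-adj v (suc t) e p = inj₂ (trans (cong suc (toℕ-fromℕ< p)) (sym e))
  sides-differ : ∀ t → before n t < n → suc t < n → before n t ≢ suc t
  sides-differ zero    p _ = contradiction p (<-irrefl refl)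
  sides-differ (suc t) _ _ = λ ()

cyclic-suc : (n : ℕ) .{{_ : NonZero n}} → ℕ → ℕ
cyclic-suc n j = suc j % n

cycle-neighbourhood : ∀ m → 2 ≤ m → Neighbourhood (CycleAdj (suc m)) (before m) (cyclic-suc (suc m))
cycle-neighbourhood m 2≤m = record
  { neighbour    = neighbour
  ; left-adj     = λ v → left-adj v (toℕ v) refl
  ; right-adj    = right-adj
  ; sides-differ = λ v → sides-differ (toℕ v) (toℕ<n v)
  }
  where
  n : ℕ
  n = suc m
  wraps : ∀ {j} → suc j ≡ n → cyclic-suc n j ≡ 0
  wraps e = trans (cong (_% n) e) (n%n≡0 n)
  steps : ∀ {j} → suc j < n → cyclic-suc n j ≡ suc j
  steps = m<n⇒m%n≡m
  neighbour : ∀ v w → CycleAdj n v w → toℕ w ≡ before m (toℕ v) ⊎ toℕ w ≡ cyclic-suc n (toℕ v)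
  neighbour v w (inj₁ (inj₁ e))         = inj₂ (trans (sym e) (sym (steps (subst (_< n) (sym e) (toℕ<n w)))))
  neighbour v w (inj₁ (inj₂ e))         = inj₁ (before-suc e)
  neighbour v w (inj₂ (inj₁ (v≡0 , e))) = inj₁ (trans (suc-injective e) (cong (before m) (sym v≡0)))
  neighbour v w (inj₂ (inj₂ (w≡0 , e))) = inj₂ (trans w≡0 (sym (wraps e)))
  left-adj : ∀ v t → toℕ v ≡ t → (p : before m t < n) → CycleAdj n v (fromℕ< p)
  left-adj v zero    e p = inj₂ (inj₁ (e , cong suc (toℕ-fromℕ< p)))
  left-adj v (suc t) e p = inj₁ (inj₂ (trans (cong suc (toℕ-fromℕ< p)) (sym e)))
  right-adj : ∀ v (p : cyclic-suc n (toℕ v) < n) → CycleAdj n v (fromℕ< p)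
  right-adj v p with m≤n⇒m<n∨m≡n (toℕ<n v)
  ... | inj₁ inside = inj₁ (inj₁ (sym (trans (toℕ-fromℕ< p) (steps inside))))
  ... | inj₂ last   = inj₂ (inj₂ (trans (toℕ-fromℕ< p) (wraps last) , last))
  m≢1 : m ≢ 1
  m≢1 refl = contradiction 2≤m λ { (s≤s ()) }
  sides-differ : ∀ t → t < n → before m t < n → cyclic-suc n t < n → before m t ≢ cyclic-suc n t
  sides-differ zero    _   _ _ e = m≢1 (trans e (steps (s≤s (≤-trans (s≤s z≤n) 2≤m))))
  sides-differ (suc t) t<n _ _ e with m≤n⇒m<n∨m≡n t<n
  ... | inj₁ inside = contradiction (trans e (steps inside)) λ ()
  ... | inj₂ last   = m≢1 (trans (sym (suc-injective last)) (cong suc (trans e (wraps last))))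

vertexLabels : (n : ℕ) → Seq → Fin n → Label
vertexLabels n s v = s (suc (toℕ v))

extend-sequence : ∀ {n} s {k} (k<n : k < n) → extend (vertexLabels n s) k ≡ s (suc k)
extend-sequence s k<n = trans (extend-inside _ k<n) (cong (λ j → s (suc j)) (toℕ-fromℕ< k<n))

record Frames (n : ℕ) (left right : ℕ → ℕ) (s : Seq) : Set where
  constructor framing
  field
    framed : ∀ j → j < n →
      extend (vertexLabels n s) (left j) ≡ s j × extend (vertexLabels n s) (right j) ≡ s (suc (suc j))

module _ {n : ℕ} {left right : ℕ → ℕ} {s : Seq} (frames : Frames n left right s) where
  open Frames frames

  frames-local : ValidUpTo n s → LocallyValid left right (vertexLabels n s)
  frames-local valid v =
    valid-cong (sym (proj₁ (framed (toℕ v) (toℕ<n v)))) refl (sym (proj₂ (framed (toℕ v) (toℕ<n v))))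
      (valid (toℕ v) (toℕ<n v))

  local-frames : LocallyValid left right (vertexLabels n s) → ValidUpTo n s
  local-frames local i i<n =
    valid-cong (proj₁ (framed i i<n)) refl (proj₂ (framed i i<n))
      (subst (λ j → Valid (extend ψ (left j)) (s (suc j)) (extend ψ (right j)))
             (toℕ-fromℕ< i<n) (local (fromℕ< i<n)))
    where
    ψ : Fin n → Label
    ψ = vertexLabels n s

path-frames : ∀ n s → s 0 ≡ L0 → s (suc n) ≡ L0 → Frames n (before n) suc s
path-frames n s left-end right-end = framing λ j j<n → left j j<n , right j j<n
  where
  left : ∀ i → i < n → extend (vertexLabels n s) (before n i) ≡ s i
  left zero    _   = trans (extend-outside (vertexLabels n s) ≤-refl) (sym left-end)
  left (suc k) i<n = extend-sequence s (<-trans (n<1+n k) i<n)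
  right : ∀ j → j < n → extend (vertexLabels n s) (suc j) ≡ s (suc (suc j))
  right j j<n with m≤n⇒m<n∨m≡n j<n
  ... | inj₁ inside = extend-sequence s inside
  ... | inj₂ last   = trans (extend-outside (vertexLabels n s) (≤-reflexive (sym last)))
                            (sym (trans (cong (λ i → s (suc i)) last) right-end))

cycle-frames : ∀ m s → s (suc m) ≡ s 0 → s (suc (suc m)) ≡ s 1 →
               Frames (suc m) (before m) (cyclic-suc (suc m)) s
cycle-frames m s wrap₀ wrap₁ = framing λ j j<n → left j j<n , right j j<n
  where
  n : ℕ
  n = suc m
  ψ : Fin n → Label
  ψ = vertexLabels n s
  left : ∀ i → i < n → extend ψ (before m i) ≡ s i
  left zero    _   = trans (extend-sequence s (n<1+n m)) wrap₀
  left (suc k) i<n = extend-sequence s (<-trans (n<1+n k) i<n)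
  right : ∀ j → j < n → extend ψ (cyclic-suc n j) ≡ s (suc (suc j))
  right j j<n with m≤n⇒m<n∨m≡n j<n
  ... | inj₁ inside = trans (cong (extend ψ) (m<n⇒m%n≡m inside)) (extend-sequence s inside)
  ... | inj₂ last   = begin
    extend ψ (suc j % n) ≡⟨ cong (λ i → extend ψ (i % n)) last ⟩
    extend ψ (n % n)     ≡⟨ cong (extend ψ) (n%n≡0 n) ⟩
    extend ψ 0           ≡⟨ extend-sequence {n} s (s≤s z≤n) ⟩
    s 1                  ≡⟨ wrap₁ ⟨
    s (suc n)            ≡⟨ cong (λ i → s (suc i)) last ⟨
    s (suc (suc j))      ∎
    where open ≡-Reasoning

sum-tabulate : ∀ n (f : Fin n → ℕ) (g : ℕ → ℕ) → (∀ v → f v ≡ g (toℕ v)) → sum (tabulate f) ≡ sumBelow n g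
sum-tabulate zero    f g agree = refl
sum-tabulate (suc n) f g agree =
  cong₂ _+_ (agree Fin.zero) (sum-tabulate n (λ v → f (Fin.suc v)) (λ i → g (suc i)) (λ v → agree (Fin.suc v)))

weight-as-sum : ∀ {n} (f : Labeling n) (g : ℕ → ℕ) → (∀ v → f v ≡ g (toℕ v)) → weight f ≡ sumBelow n g
weight-as-sum {n} f g agree = trans (cong sum (map-tabulate id f)) (sum-tabulate n f g agree)

Achieves : ∀ {n} → Graph n → ℕ → Set
Achieves G m = ∃[ f ] (IsIDRDF G f × weight f ≡ m)

path-idrdf : ∀ {n s} → IsPathSequence n s → Achieves (PathAdj n) (weightOf n s)
path-idrdf {n} {s} path =
  (λ v → val (s (suc (toℕ v)))) ,
  ToIDRDF.idrdf (path-neighbourhood n) (vertexLabels n s) (frames-local (path-frames n s left-end right-end) windows) ,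
  weight-as-sum {n} _ (λ i → val (s (suc i))) (λ _ → refl)
  where open IsPathSequence path

path-sequence : ∀ {n f} → IsIDRDF (PathAdj n) f → Σ[ s ∈ Seq ] (IsPathSequence n s × weight f ≡ weightOf n s)
path-sequence {n} {f} idrdf =
  s ,
  record { windows   = local-frames (path-frames n s refl right-end) (local-cong {left = before n} {right = suc} agree local)
         ; left-end  = refl
         ; right-end = right-end } ,
  weight-as-sum f (λ i → val (s (suc i))) (λ v → trans (faithful v) (cong val (agree v)))
  where
  open FromIDRDF (path-neighbourhood n) idrdf
  s : Seq
  s = L0 ◂ extend φ
  agree : ∀ v → φ v ≡ vertexLabels n s v
  agree v = sym (extend-vertex φ v)
  right-end : s (suc n) ≡ L0
  right-end = extend-outside φ ≤-refl

cycle-idrdf : ∀ {m s} → 2 ≤ m → IsCycleSequence (suc m) s → Achieves (CycleAdj (suc m)) (weightOf (suc m) s)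
cycle-idrdf {m} {s} 2≤m cycle =
  (λ v → val (s (suc (toℕ v)))) ,
  ToIDRDF.idrdf (cycle-neighbourhood m 2≤m) (vertexLabels (suc m) s) (frames-local (cycle-frames m s wrap₀ wrap₁) windows) ,
  weight-as-sum {suc m} _ (λ i → val (s (suc i))) (λ _ → refl)
  where open IsCycleSequence cycle

cycle-sequence : ∀ {m f} → 2 ≤ m → IsIDRDF (CycleAdj (suc m)) f →
                 Σ[ s ∈ Seq ] (IsCycleSequence (suc m) s × weight f ≡ weightOf (suc m) s)
cycle-sequence {m} {f} 2≤m idrdf =
  s ,
  record { windows = local-frames (cycle-frames m s wrap₀ wrap₁) (local-cong {left = before m} {right = cyclic-suc n} agree local)
         ; wrap₀   = wrap₀
         ; wrap₁   = wrap₁ } ,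
  weight-as-sum f (λ i → val (s (suc i))) (λ v → trans (faithful v) (cong val (agree v)))
  where
  open FromIDRDF (cycle-neighbourhood m 2≤m) idrdf
  n : ℕ
  n = suc m
  s : Seq
  s = extend φ m ◂ (λ i → extend φ (i % n))
  agree : ∀ v → φ v ≡ vertexLabels n s v
  agree v = sym (trans (cong (extend φ) (m<n⇒m%n≡m (toℕ<n v))) (extend-vertex φ v))
  wrap₀ : s n ≡ s 0
  wrap₀ = cong (extend φ) (m<n⇒m%n≡m (n<1+n m))
  wrap₁ : s (suc n) ≡ s 1
  wrap₁ = cong (extend φ) (n%n≡0 n)

above-unless-extremal : ∀ {n W} {P : Set} → n ≤ W → (W ≡ n → P) → ¬ P → n + 1 ≤ W
above-unless-extremal {n} {W} n≤W extremal ¬P with m≤n⇒m<n∨m≡n n≤W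
... | inj₁ n<W = subst (_≤ W) (+-comm 1 n) n<W
... | inj₂ n≡W = contradiction (extremal (sym n≡W)) ¬P

path-lower-bound : ∀ {n f} → IsIDRDF (PathAdj n) f → n ≤ weight f × (n % 3 ≢ 0 → n + 1 ≤ weight f)
path-lower-bound {n} idrdf =
  let s , path , w≡ = path-sequence idrdf
      open PathBounds path
  in subst (n ≤_) (sym w≡) lower ,
     λ n%3≢0 → subst (n + 1 ≤_) (sym w≡) (above-unless-extremal lower extremal n%3≢0)

cycle-lower-bound : ∀ {n f} → 3 ≤ n → IsIDRDF (CycleAdj n) f →
                    n ≤ weight f × (n % 2 ≢ 0 → n % 3 ≢ 0 → n + 1 ≤ weight f)
cycle-lower-bound {suc m} (s≤s 2≤m) idrdf =
  let s , cycle , w≡ = cycle-sequence 2≤m idrdf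
      open CycleBounds cycle
  in subst (suc m ≤_) (sym w≡) lower ,
     λ odd n%3≢0 → subst (suc m + 1 ≤_) (sym w≡) (above-unless-extremal lower (extremal (s≤s z≤n)) [ odd , n%3≢0 ]′)

sumBelow-cong : ∀ n {g h : ℕ → ℕ} → (∀ i → i < n → g i ≡ h i) → sumBelow n g ≡ sumBelow n h
sumBelow-cong zero    _   = refl
sumBelow-cong (suc n) g≗h = cong₂ _+_ (g≗h 0 (s≤s z≤n)) (sumBelow-cong n λ i i<n → g≗h (suc i) (s≤s i<n))

sumBelow-split : ∀ m k g → sumBelow (m + k) g ≡ sumBelow m g + sumBelow k (λ i → g (m + i))
sumBelow-split zero    k g = refl
sumBelow-split (suc m) k g =
  trans (cong (g 0 +_) (sumBelow-split m k (λ i → g (suc i)))) (sym (+-assoc (g 0) _ _))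

sumBelow-periodic : ∀ p g → (∀ i → g (p + i) ≡ g i) → ∀ q → sumBelow (q * p) g ≡ q * sumBelow p g
sumBelow-periodic p g periodic zero    = refl
sumBelow-periodic p g periodic (suc q) = begin
  sumBelow (p + q * p) g                            ≡⟨ sumBelow-split p (q * p) g ⟩
  sumBelow p g + sumBelow (q * p) (λ i → g (p + i)) ≡⟨ cong (sumBelow p g +_) (sumBelow-cong (q * p) λ i _ → periodic i) ⟩
  sumBelow p g + sumBelow (q * p) g                 ≡⟨ cong (sumBelow p g +_) (sumBelow-periodic p g periodic q) ⟩
  sumBelow p g + q * sumBelow p g                   ∎
  where open ≡-Reasoning

Everywhere : Seq → Set
Everywhere s = ∀ i → Valid (s i) (s (suc i)) (s (suc (suc i)))

everywhere-shift : ∀ {s} → Everywhere s → Everywhere (λ i → s (suc i))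
everywhere-shift valid i = valid (suc i)

everywhere-cons : ∀ {x s} → Valid x (s 0) (s 1) → Everywhere s → Everywhere (x ◂ s)
everywhere-cons first valid zero    = first
everywhere-cons first valid (suc i) = valid i

-- Positions 0 0 3 0 0 3 …, i.e. vertices labelled 0 3 0 0 3 0 …
thirds : Seq
thirds 0 = L0
thirds 1 = L0
thirds 2 = L3
thirds (suc (suc (suc i))) = thirds i

-- Positions 0 2 0 2 …, i.e. vertices labelled 2 0 2 0 …
halves : Seq
halves 0 = L0
halves 1 = L2
halves (suc (suc i)) = halves i

thirds-valid : Everywhere thirds
thirds-valid 0 = three-right
thirds-valid 1 = lone-three
thirds-valid 2 = three-left
thirds-valid (suc (suc (suc i))) = thirds-valid i

halves-valid : Everywhere halves
halves-valid 0 = lone-two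
halves-valid 1 = two-two
halves-valid (suc (suc i)) = halves-valid i

thirds-period : ∀ q i → thirds (i + q * 3) ≡ thirds i
thirds-period q i = trans (cong thirds (+-comm i (q * 3))) (shift q)
  where
  shift : ∀ q → thirds (q * 3 + i) ≡ thirds i
  shift zero    = refl
  shift (suc q) = shift q

halves-period : ∀ k i → halves (i + k * 2) ≡ halves i
halves-period k i = trans (cong halves (+-comm i (k * 2))) (shift k)
  where
  shift : ∀ k → halves (k * 2 + i) ≡ halves i
  shift zero    = refl
  shift (suc k) = shift k

close : ℕ → Seq → Seq
close zero    s = s 0 ◂ λ _ → L3
close (suc n) s = s 0 ◂ close n (λ i → s (suc i))

close-inside : ∀ n s i → i ≤ n → close n s i ≡ s i
close-inside zero    s zero    _         = refl
close-inside (suc n) s zero    _         = refl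
close-inside (suc n) s (suc i) (s≤s i≤n) = close-inside n (λ j → s (suc j)) i i≤n

close-after : ∀ n s → close n s (suc n) ≡ L3
close-after zero    s = refl
close-after (suc n) s = close-after n (λ i → s (suc i))

-- A labelling of P_{m+1} that starts with 3, ends with 0 and is valid except
-- possibly at its last vertex is a labelling of C_{m+1}: the last vertex gains
-- the neighbour 3.
closing : ∀ m s → ValidUpTo m s → s 0 ≡ L0 → s 1 ≡ L3 → s (suc m) ≡ L0 →
          IsCycleSequence (suc m) (close (suc m) s) × weightOf (suc m) (close (suc m) s) ≡ weightOf (suc m) s
closing m s valid first second last =
  record { windows = windows
         ; wrap₀   = trans (same (suc m) ≤-refl) (trans last (sym first))
         ; wrap₁   = trans (close-after (suc m) s) (sym (trans (same 1 (s≤s z≤n)) second)) } ,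
  sumBelow-cong (suc m) λ i i<n → cong val (same (suc i) i<n)
  where
  same : ∀ i → i ≤ suc m → close (suc m) s i ≡ s i
  same = close-inside (suc m) s
  windows : ValidUpTo (suc m) (close (suc m) s)
  windows i (s≤s i≤m) with m≤n⇒m<n∨m≡n i≤m
  ... | inj₁ i<m  = valid-cong (sym (same i (m≤n⇒m≤1+n i≤m))) (sym (same (suc i) (s≤s i≤m)))
                               (sym (same (suc (suc i)) (s≤s i<m))) (valid i i<m)
  ... | inj₂ refl = valid-cong (sym (same i (m≤n⇒m≤1+n i≤m))) (sym (trans (same (suc i) ≤-refl) last))
                               (sym (close-after (suc i) s)) three-right

-- Vertices labelled 3 0 0 3 0 0 …
thirds⁺ : Seq
thirds⁺ i = thirds (suc i)

-- Vertices labelled 2 0 3 0 0 3 0 0 …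
two-then-thirds : Seq
two-then-thirds = L0 ◂ (L2 ◂ thirds⁺)

-- Vertices labelled 3 0 2 0 3 0 0 3 0 0 …
three-two-then-thirds : Seq
three-two-then-thirds = L0 ◂ (L3 ◂ (L0 ◂ (L2 ◂ thirds⁺)))

thirds-sum₁ : ∀ q → sumBelow (q * 3) (λ i → val (thirds (suc i))) ≡ q * 3
thirds-sum₁ = sumBelow-periodic 3 (λ i → val (thirds (suc i))) (λ _ → refl)

thirds-sum₂ : ∀ q → sumBelow (q * 3) (λ i → val (thirds (suc (suc i)))) ≡ q * 3
thirds-sum₂ = sumBelow-periodic 3 (λ i → val (thirds (suc (suc i)))) (λ _ → refl)

path-thirds : ∀ q → IsPathSequence (q * 3) thirds × weightOf (q * 3) thirds ≡ q * 3
path-thirds q =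
  record { windows = λ i _ → thirds-valid i ; left-end = refl ; right-end = thirds-period q 1 } ,
  thirds-sum₁ q

path-two-then-thirds : ∀ q → IsPathSequence (1 + q * 3) two-then-thirds
                             × weightOf (1 + q * 3) two-then-thirds ≡ 2 + q * 3
path-two-then-thirds q =
  record { windows   = λ i _ → everywhere-cons lone-two (everywhere-cons three-right (everywhere-shift thirds-valid)) i
         ; left-end  = refl
         ; right-end = thirds-period q 1 } ,
  cong (2 +_) (thirds-sum₁ q)

path-thirds⁺ : ∀ q → IsPathSequence (2 + q * 3) thirds⁺ × weightOf (2 + q * 3) thirds⁺ ≡ 3 + q * 3
path-thirds⁺ q =
  record { windows = λ i _ → thirds-valid (suc i) ; left-end = refl ; right-end = thirds-period q 1 } ,
  cong (3 +_) (thirds-sum₁ q)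

cycle-halves : ∀ k → IsCycleSequence (k * 2) halves × weightOf (k * 2) halves ≡ k * 2
cycle-halves k =
  record { windows = λ i _ → halves-valid i ; wrap₀ = halves-period k 0 ; wrap₁ = halves-period k 1 } ,
  sumBelow-periodic 2 (λ i → val (halves (suc i))) (λ _ → refl) k

cycle-thirds : ∀ q → IsCycleSequence (q * 3) thirds × weightOf (q * 3) thirds ≡ q * 3
cycle-thirds q =
  record { windows = λ i _ → thirds-valid i ; wrap₀ = thirds-period q 0 ; wrap₁ = thirds-period q 1 } ,
  thirds-sum₁ q

cycle-thirds⁺ : ∀ q → Σ[ s ∈ Seq ] (IsCycleSequence (2 + q * 3) s × weightOf (2 + q * 3) s ≡ 3 + q * 3)
cycle-thirds⁺ q =
  let cycle , same-weight = closing (1 + q * 3) thirds⁺ (λ i _ → thirds-valid (suc i)) refl refl (thirds-period q 0)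
  in close (2 + q * 3) thirds⁺ , cycle , trans same-weight (proj₂ (path-thirds⁺ q))

cycle-three-two-then-thirds : ∀ q → Σ[ s ∈ Seq ] (IsCycleSequence (4 + q * 3) s × weightOf (4 + q * 3) s ≡ 5 + q * 3)
cycle-three-two-then-thirds q =
  let valid = everywhere-cons lone-three (everywhere-cons three-left (everywhere-cons lone-two
                (everywhere-cons three-right (everywhere-shift thirds-valid))))
      cycle , same-weight = closing (3 + q * 3) three-two-then-thirds (λ i _ → valid i) refl refl (thirds-period q 1)
  in close (4 + q * 3) three-two-then-thirds , cycle , trans same-weight (cong (5 +_) (thirds-sum₂ q))

path-achieves : ∀ {n s w} → IsPathSequence n s × weightOf n s ≡ w → Achieves (PathAdj n) w
path-achieves (path , refl) = path-idrdf path

cycle-achieves : ∀ {n s w} → 3 ≤ n → IsCycleSequence n s × weightOf n s ≡ w → Achieves (CycleAdj n) w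
cycle-achieves {suc m} (s≤s 2≤m) (cycle , refl) = cycle-idrdf 2≤m cycle

achieves-at : ∀ (G : (k : ℕ) → Graph k) {n k w m} → n ≡ k → w ≡ m → Achieves (G k) w → Achieves (G n) m
achieves-at G refl refl witness = witness

residue : ∀ n d .{{_ : NonZero d}} {r} → n % d ≡ r → n ≡ r + n / d * d
residue n d e = trans (m≡m%n+[m/n]*n n d) (cong (_+ n / d * d) e)

successor-weight : ∀ {n} r q → n ≡ r + q * 3 → suc r + q * 3 ≡ n + 1
successor-weight r q n≡ = sym (trans (cong (_+ 1) n≡) (+-comm (r + q * 3) 1))

nonzero-residue₃ : ∀ n → n % 3 ≢ 0 → n % 3 ≡ 1 ⊎ n % 3 ≡ 2
nonzero-residue₃ n n%3≢0 with n % 3 | m%n<n n 3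
... | 0 | _ = contradiction refl n%3≢0
... | 1 | _ = inj₁ refl
... | 2 | _ = inj₂ refl
... | suc (suc (suc _)) | s≤s (s≤s (s≤s ()))

mod6-mod2 : ∀ n {r} → n % 6 ≡ r → n % 2 ≡ r % 2
mod6-mod2 n e = trans (sym (m∣n⇒o%n%m≡o%m 2 6 n (divides 3 refl))) (cong (_% 2) e)

mod6-mod3 : ∀ n {r} → n % 6 ≡ r → n % 3 ≡ r % 3
mod6-mod3 n e = trans (sym (m∣n⇒o%n%m≡o%m 3 6 n (divides 2 refl))) (cong (_% 3) e)

mod6-divisor : ∀ n → n % 6 ≡ 0 ⊎ n % 6 ≡ 2 ⊎ n % 6 ≡ 3 ⊎ n % 6 ≡ 4 → n % 2 ≡ 0 ⊎ n % 3 ≡ 0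
mod6-divisor n (inj₁ r)               = inj₁ (mod6-mod2 n r)
mod6-divisor n (inj₂ (inj₁ r))        = inj₁ (mod6-mod2 n r)
mod6-divisor n (inj₂ (inj₂ (inj₁ r))) = inj₂ (mod6-mod3 n r)
mod6-divisor n (inj₂ (inj₂ (inj₂ r))) = inj₁ (mod6-mod2 n r)

mod6-coprime : ∀ n → n % 6 ≡ 1 ⊎ n % 6 ≡ 5 → n % 2 ≢ 0 × n % 3 ≢ 0
mod6-coprime n (inj₁ r) = (λ e → contradiction (trans (sym (mod6-mod2 n r)) e) λ ()) ,
                          (λ e → contradiction (trans (sym (mod6-mod3 n r)) e) λ ())
mod6-coprime n (inj₂ r) = (λ e → contradiction (trans (sym (mod6-mod2 n r)) e) λ ()) ,
                          (λ e → contradiction (trans (sym (mod6-mod3 n r)) e) λ ())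

path-exact : ∀ n → n % 3 ≡ 0 → Achieves (PathAdj n) n
path-exact n n%3≡0 = achieves-at PathAdj n≡ (sym n≡) (path-achieves (path-thirds (n / 3)))
  where
  n≡ : n ≡ n / 3 * 3
  n≡ = residue n 3 n%3≡0

path-near : ∀ n → n % 3 ≢ 0 → Achieves (PathAdj n) (n + 1)
path-near n n%3≢0 with nonzero-residue₃ n n%3≢0
... | inj₁ n%3≡1 = achieves-at PathAdj n≡ (successor-weight 1 (n / 3) n≡) (path-achieves (path-two-then-thirds (n / 3)))
  where
  n≡ : n ≡ 1 + n / 3 * 3
  n≡ = residue n 3 n%3≡1
... | inj₂ n%3≡2 = achieves-at PathAdj n≡ (successor-weight 2 (n / 3) n≡) (path-achieves (path-thirds⁺ (n / 3)))
  where
  n≡ : n ≡ 2 + n / 3 * 3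
  n≡ = residue n 3 n%3≡2

cycle-exact : ∀ n → 3 ≤ n → n % 2 ≡ 0 ⊎ n % 3 ≡ 0 → Achieves (CycleAdj n) n
cycle-exact n 3≤n (inj₁ n%2≡0) =
  achieves-at CycleAdj n≡ (sym n≡) (cycle-achieves (subst (3 ≤_) n≡ 3≤n) (cycle-halves (n / 2)))
  where
  n≡ : n ≡ n / 2 * 2
  n≡ = residue n 2 n%2≡0
cycle-exact n 3≤n (inj₂ n%3≡0) =
  achieves-at CycleAdj n≡ (sym n≡) (cycle-achieves (subst (3 ≤_) n≡ 3≤n) (cycle-thirds (n / 3)))
  where
  n≡ : n ≡ n / 3 * 3
  n≡ = residue n 3 n%3≡0

cycle-one-more : ∀ Q → 3 ≤ 1 + Q * 3 → Achieves (CycleAdj (1 + Q * 3)) (2 + Q * 3)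
cycle-one-more zero    (s≤s ())
cycle-one-more (suc q) 3≤n = cycle-achieves 3≤n (proj₂ (cycle-three-two-then-thirds q))

cycle-near : ∀ n → 3 ≤ n → n % 3 ≢ 0 → Achieves (CycleAdj n) (n + 1)
cycle-near n 3≤n n%3≢0 with nonzero-residue₃ n n%3≢0
... | inj₁ n%3≡1 =
  achieves-at CycleAdj n≡ (successor-weight 1 (n / 3) n≡) (cycle-one-more (n / 3) (subst (3 ≤_) n≡ 3≤n))
  where
  n≡ : n ≡ 1 + n / 3 * 3
  n≡ = residue n 3 n%3≡1
... | inj₂ n%3≡2 =
  achieves-at CycleAdj n≡ (successor-weight 2 (n / 3) n≡)
    (cycle-achieves (subst (3 ≤_) n≡ 3≤n) (proj₂ (cycle-thirds⁺ (n / 3))))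
  where
  n≡ : n ≡ 2 + n / 3 * 3
  n≡ = residue n 3 n%3≡2

path-theorem : (n : ℕ) → 1 ≤ n →
    (n % 3 ≡ 0 → IsIdRNumber (PathAdj n) n)
  × (n % 3 ≢ 0 → IsIdRNumber (PathAdj n) (n + 1))
path-theorem n _ =
  (λ n%3≡0 → path-exact n n%3≡0 , λ f idrdf → proj₁ (path-lower-bound idrdf)) ,
  (λ n%3≢0 → path-near n n%3≢0 , λ f idrdf → proj₂ (path-lower-bound idrdf) n%3≢0)

cycle-theorem : (n : ℕ) → 3 ≤ n →
    ((n % 6 ≡ 0 ⊎ n % 6 ≡ 2 ⊎ n % 6 ≡ 3 ⊎ n % 6 ≡ 4) → IsIdRNumber (CycleAdj n) n)
  × ((n % 6 ≡ 1 ⊎ n % 6 ≡ 5) → IsIdRNumber (CycleAdj n) (n + 1))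
cycle-theorem n 3≤n =
  (λ r → cycle-exact n 3≤n (mod6-divisor n r) , λ f idrdf → proj₁ (cycle-lower-bound 3≤n idrdf)) ,
  (λ r → let odd , n%3≢0 = mod6-coprime n r
         in cycle-near n 3≤n n%3≢0 , λ f idrdf → proj₂ (cycle-lower-bound 3≤n idrdf) odd n%3≢0)

proposition3 :
    ((n : ℕ) → 1 ≤ n →
       (n % 3 ≡ 0 → IsIdRNumber (PathAdj n) n)
       × (n % 3 ≢ 0 → IsIdRNumber (PathAdj n) (n + 1)))
    × ((n : ℕ) → 3 ≤ n →
       ((n % 6 ≡ 0 ⊎ n % 6 ≡ 2 ⊎ n % 6 ≡ 3 ⊎ n % 6 ≡ 4) → IsIdRNumber (CycleAdj n) n)
       × ((n % 6 ≡ 1 ⊎ n % 6 ≡ 5) → IsIdRNumber (CycleAdj n) (n + 1)))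
proposition3 = path-theorem , cycle-theorem
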